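{- Let $c\in\mathbb{Q}$. For every $u\in\mathbb{Q}x+\mathbb{Q}y$ and every $w\in\mathfrak{H}$, \[ \tilde\theta(uw)=u\bigl(\tilde\theta(w)+zw+c\,(w\diamond y)\bigr). \]
   Context: Let $\mathfrak{H}=\mathbb{Q}\langle x,y\rangle$ be the noncommutative polynomial algebra in $x,y$, and set $z=x+y$. $\partial_1$ is the $\mathbb{Q}$-linear derivation of $\mathfrak{H}$ with $\partial_1(x)=yx$, $\partial_1(y)=-yx$. Let $H:\mathfrak{H}\to\mathfrak{H}$ be the $\mathbb{Q}$-linear map with $H(w)=\deg(w)\,w$ for every monomial $w$. For $c\in\mathbb{Q}$, $\theta=\theta^{(c)}$ is the unique $\mathbb{Q}$-linear map with $\theta(1)=0$, $\theta(x)=xz$, $\theta(y)=yz$ and $\theta(ww')=\theta(w)w'+w\theta(w')+cH(w)\partial_1(w')$ for all $w,w'\in\mathfrak{H}$; and $\tilde\theta(w)=\theta(w)+cH(w)y$. The harmonic product $*$ on $\mathfrak{H}$ is defined recursively by $1*w=w*1=w$, $xw_1*w_2=w_1*xw_2=x(w_1*w_2)$, $yw_1*yw_2=y(w_1*yw_2)+y(yw_1*w_2)+yx(w_1*w_2)$. Let $\phi$ be the algebra automorphism with $\phi(x)=z$, $\phi(y)=-y$, and $w_1\diamond w_2=\phi(\phi(w_1)*\phi(w_2))$. -}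

module Defs where

open import Data.Nat using (ℕ)
open import Data.Integer using (+_)
open import Data.Rational using (ℚ; 0ℚ; 1ℚ; _/_; -_) renaming (_+_ to _+ℚ_; _*_ to _*ℚ_)
open import Data.List using (List; []; _∷_; _++_; map; length; concatMap)
open import Data.Product using (_×_; _,_)
open import Relation.Nullary using (yes; no)
open import Relation.Binary.PropositionalEquality using (_≡_; refl)
open import Relation.Binary.Definitions using (DecidableEquality)
import Data.List.Properties as LP

data Letter : Set where
  x y : Letter

_≟L_ : DecidableEquality Letter
x ≟L x = yes refl
x ≟L y = no λ ()
y ≟L x = no λ ()
y ≟L y = yes refl

Word : Set
Word = List Letter

_≟W_ : DecidableEquality Word
_≟W_ = LP.≡-dec _≟L_

-- a polynomial is a finite formal ℚ-linear combination of words
-- (duplicate words / zero coefficients allowed; equality is ≈ below)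
𝔥 : Set
𝔥 = List (ℚ × Word)

coeff : Word → 𝔥 → ℚ
coeff w [] = 0ℚ
coeff w ((a , v) ∷ p) with v ≟W w
... | yes _ = a +ℚ coeff w p
... | no _  = coeff w p

infix 4 _≈_
_≈_ : 𝔥 → 𝔥 → Set
p ≈ q = ∀ w → coeff w p ≡ coeff w q

mono : Word → 𝔥
mono w = (1ℚ , w) ∷ []

𝟘 : 𝔥
𝟘 = []

infixl 6 _⊕_
_⊕_ : 𝔥 → 𝔥 → 𝔥
p ⊕ q = p ++ q

infixl 7 _·_
_·_ : ℚ → 𝔥 → 𝔥
a · p = map (λ { (b , v) → (a *ℚ b , v) }) p

infixl 7 _⊗_
_⊗_ : 𝔥 → 𝔥 → 𝔥
p ⊗ q = concatMap (λ { (a , v) → map (λ { (b , v') → (a *ℚ b , v ++ v') }) q }) p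

lin : (Word → 𝔥) → 𝔥 → 𝔥
lin f p = concatMap (λ { (a , v) → a · f v }) p

bilin : (Word → Word → 𝔥) → 𝔥 → 𝔥 → 𝔥
bilin f p q = concatMap (λ { (a , v) → concatMap (λ { (b , v') → (a *ℚ b) · f v v' }) q }) p

X Y Z : 𝔥
X = mono (x ∷ [])
Y = mono (y ∷ [])
Z = X ⊕ Y

letter : Letter → 𝔥
letter l = mono (l ∷ [])

ℕtoℚ : ℕ → ℚ
ℕtoℚ n = (+ n) / 1

∂₁L : Letter → 𝔥
∂₁L x = mono (y ∷ x ∷ [])
∂₁L y = (- 1ℚ) · mono (y ∷ x ∷ [])

∂₁W : Word → 𝔥
∂₁W [] = 𝟘
∂₁W (l ∷ w) = ∂₁L l ⊗ mono w ⊕ letter l ⊗ ∂₁W w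

∂₁ : 𝔥 → 𝔥
∂₁ = lin ∂₁W

H : 𝔥 → 𝔥
H = lin (λ w → ℕtoℚ (length w) · mono w)

-- θ = θ^(c): θ(1)=0, θ(x)=xz, θ(y)=yz,
-- θ(ww') = θ(w)w' + wθ(w') + c H(w) ∂₁(w').
-- Defined on words by splitting off the first letter (w = l, w' = rest).

θW : ℚ → Word → 𝔥
θW c [] = 𝟘
θW c (l ∷ w) = (letter l ⊗ Z) ⊗ mono w ⊕ letter l ⊗ θW c w
               ⊕ c · (H (letter l) ⊗ ∂₁W w)

θ : ℚ → 𝔥 → 𝔥
θ c = lin (θW c)

θ̃ : ℚ → 𝔥 → 𝔥
θ̃ c w = θ c w ⊕ c · (H w ⊗ Y)

_*W_ : Word → Word → 𝔥
[] *W w = mono w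
(l ∷ w₁) *W [] = mono (l ∷ w₁)
(x ∷ w₁) *W w₂ = letter x ⊗ (w₁ *W w₂)
(y ∷ w₁) *W (x ∷ w₂) = letter x ⊗ ((y ∷ w₁) *W w₂)
(y ∷ w₁) *W (y ∷ w₂) = letter y ⊗ (w₁ *W (y ∷ w₂))
                       ⊕ letter y ⊗ ((y ∷ w₁) *W w₂)
                       ⊕ mono (y ∷ x ∷ []) ⊗ (w₁ *W w₂)

infixl 7 _*_
_*_ : 𝔥 → 𝔥 → 𝔥
_*_ = bilin _*W_

φL : Letter → 𝔥
φL x = Z
φL y = (- 1ℚ) · Y

φW : Word → 𝔥
φW [] = mono []
φW (l ∷ w) = φL l ⊗ φW w

φ : 𝔥 → 𝔥
φ = lin φW

infixl 7 _⋄_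
_⋄_ : 𝔥 → 𝔥 → 𝔥
w₁ ⋄ w₂ = φ (φ w₁ * φ w₂)

-- For a letter l the defining rule of θ gives θ(l w) = l z w + l θ(w) + c l ∂₁(w), and
-- H(l w) y = (1 + deg w) l w y, so θ̃(l w) = l (θ̃(w) + z w + c (∂₁(w) + w y)).  The theorem
-- then reduces to w ⋄ y = ∂₁(w) + w y.  Since φ(y) = -y, this says φ(φ(w) * y) =
-- -(∂₁(w) + w y), which follows by induction on the first letter of w from the recursion
-- of the harmonic product with y and φ² = id.  All identities are tested against every
-- linear functional on 𝔥: this turns each linear map into its transpose, a recursion on
-- words, and avoids any quotienting of the list representation of 𝔥.
module Submission where

open import Defs
open import Data.Rational using (ℚ)

open import Algebra.Bundles using (CommutativeRing)
open import Data.Integer using (+_)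
import Data.Integer.Solver as ℤ
open import Data.List using ([]; _∷_; _++_; [_]; length)
open import Data.List.Properties using (++-identityʳ; ++-assoc)
open import Data.Nat using (suc)
open import Data.Product using (_,_)
open import Data.Rational using (0ℚ; 1ℚ; -_; toℚᵘ) renaming (_+_ to _+ℚ_; _*_ to _*ℚ_)
open import Data.Rational.Properties
  using (+-identityˡ; +-identityʳ; +-assoc; *-identityˡ; *-identityʳ; *-zeroʳ; *-assoc;
         *-distribˡ-+; toℚᵘ-injective; toℚᵘ-fromℚᵘ; toℚᵘ-homo-+; +-*-commutativeRing)
open import Data.Rational.Solver using (module +-*-Solver)
import Data.Rational.Unnormalised as ℚᵘ
import Data.Rational.Unnormalised.Properties as ℚᵘ
open import Relation.Nullary using (yes; no)
open import Relation.Binary.PropositionalEquality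
  using (_≡_; _≗_; refl; sym; trans; cong; cong₂; module ≡-Reasoning)

open import Algebra.Properties.Ring (CommutativeRing.ring +-*-commutativeRing)
  using (-‿involutive; -1*x≈-x)

ℕtoℚ-suc : ∀ n → ℕtoℚ (suc n) ≡ 1ℚ +ℚ ℕtoℚ n
ℕtoℚ-suc n = toℚᵘ-injective (begin
  toℚᵘ (ℕtoℚ (suc n))
    ≈⟨ toℚᵘ-fromℚᵘ (ℚᵘ.mkℚᵘ (+ suc n) 0) ⟩
  ℚᵘ.mkℚᵘ (+ suc n) 0
    ≈⟨ ℚᵘ.*≡* (solve 1 (λ m → (con (+ 1) :+ m) :* (con (+ 1) :* con (+ 1))
                            := (con (+ 1) :* con (+ 1) :+ m :* con (+ 1)) :* con (+ 1))
                         refl (+ n)) ⟩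
  ℚᵘ.1ℚᵘ ℚᵘ.+ ℚᵘ.mkℚᵘ (+ n) 0
    ≈⟨ ℚᵘ.+-congʳ ℚᵘ.1ℚᵘ (toℚᵘ-fromℚᵘ (ℚᵘ.mkℚᵘ (+ n) 0)) ⟨
  toℚᵘ 1ℚ ℚᵘ.+ toℚᵘ (ℕtoℚ n)
    ≈⟨ toℚᵘ-homo-+ 1ℚ (ℕtoℚ n) ⟨
  toℚᵘ (1ℚ +ℚ ℕtoℚ n) ∎)
  where open ℚᵘ.≃-Reasoning
        open ℤ.+-*-Solver

open +-*-Solver
open ≡-Reasoning

factorˡ : ∀ a b c d → a *ℚ b *ℚ c +ℚ a *ℚ d ≡ a *ℚ (b *ℚ c +ℚ d)
factorˡ a b c d = trans (cong (_+ℚ a *ℚ d) (*-assoc a b c)) (sym (*-distribˡ-+ a (b *ℚ c) d))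

ev : (Word → ℚ) → 𝔥 → ℚ
ev g [] = 0ℚ
ev g ((a , v) ∷ p) = a *ℚ g v +ℚ ev g p

infix 4 _≅_
_≅_ : 𝔥 → 𝔥 → Set
p ≅ q = ∀ g → ev g p ≡ ev g q

shiftˡ : Word → (Word → ℚ) → Word → ℚ
shiftˡ v g t = g (v ++ t)

infix 10 _ᵀ
_ᵀ : (Word → 𝔥) → (Word → ℚ) → Word → ℚ
(f ᵀ) g t = ev g (f t)

ev-⊕ : ∀ g p q → ev g (p ⊕ q) ≡ ev g p +ℚ ev g q
ev-⊕ g [] q = sym (+-identityˡ (ev g q))
ev-⊕ g ((a , v) ∷ p) q =
  trans (cong (a *ℚ g v +ℚ_) (ev-⊕ g p q)) (sym (+-assoc (a *ℚ g v) (ev g p) (ev g q)))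

ev-· : ∀ g a p → ev g (a · p) ≡ a *ℚ ev g p
ev-· g a [] = sym (*-zeroʳ a)
ev-· g a ((b , v) ∷ p) = trans (cong (a *ℚ b *ℚ g v +ℚ_) (ev-· g a p)) (factorˡ a b (g v) (ev g p))

ev-mono : ∀ g v → ev g (mono v) ≡ g v
ev-mono g v = trans (+-identityʳ (1ℚ *ℚ g v)) (*-identityˡ (g v))

ev-cong : ∀ {f f′} → f ≗ f′ → ∀ p → ev f p ≡ ev f′ p
ev-cong f≗f′ [] = refl
ev-cong f≗f′ ((a , v) ∷ p) = cong₂ (λ b c → a *ℚ b +ℚ c) (f≗f′ v) (ev-cong f≗f′ p)

ev-+ : ∀ f f′ p → ev (λ t → f t +ℚ f′ t) p ≡ ev f p +ℚ ev f′ p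
ev-+ f f′ [] = sym (+-identityʳ 0ℚ)
ev-+ f f′ ((a , v) ∷ p) = trans (cong (a *ℚ (f v +ℚ f′ v) +ℚ_) (ev-+ f f′ p))
  (solve 5 (λ a b b′ c c′ → a :* (b :+ b′) :+ (c :+ c′) := (a :* b :+ c) :+ (a :* b′ :+ c′))
     refl a (f v) (f′ v) (ev f p) (ev f′ p))

ev-*ℚ : ∀ c f p → ev (λ t → c *ℚ f t) p ≡ c *ℚ ev f p
ev-*ℚ c f [] = sym (*-zeroʳ c)
ev-*ℚ c f ((a , v) ∷ p) = trans (cong (a *ℚ (c *ℚ f v) +ℚ_) (ev-*ℚ c f p))
  (solve 4 (λ a c b d → a :* (c :* b) :+ c :* d := c :* (a :* b :+ d)) refl a c (f v) (ev f p))

ev-neg : ∀ f p → ev (λ t → - f t) p ≡ - ev f p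
ev-neg f [] = refl
ev-neg f ((a , v) ∷ p) = trans (cong (a *ℚ (- f v) +ℚ_) (ev-neg f p))
  (solve 3 (λ a b d → a :* (:- b) :+ (:- d) := :- (a :* b :+ d)) refl a (f v) (ev f p))

ev-term⊗ : ∀ g a v q → ev g (((a , v) ∷ []) ⊗ q) ≡ a *ℚ ev (shiftˡ v g) q
ev-term⊗ g a v [] = sym (*-zeroʳ a)
ev-term⊗ g a v ((b , u) ∷ q) =
  trans (cong (a *ℚ b *ℚ g (v ++ u) +ℚ_) (ev-term⊗ g a v q)) (factorˡ a b _ _)

⊗-cons : ∀ t p q → (t ∷ p) ⊗ q ≡ (t ∷ []) ⊗ q ⊕ p ⊗ q
⊗-cons t p q = cong (_⊕ p ⊗ q) (sym (++-identityʳ _))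

ev-⊗ : ∀ g p q → ev g (p ⊗ q) ≡ ev (λ v → ev (shiftˡ v g) q) p
ev-⊗ g [] q = refl
ev-⊗ g ((a , v) ∷ p) q = begin
  ev g (((a , v) ∷ p) ⊗ q)
    ≡⟨ cong (ev g) (⊗-cons (a , v) p q) ⟩
  ev g (((a , v) ∷ []) ⊗ q ⊕ p ⊗ q)
    ≡⟨ ev-⊕ g (((a , v) ∷ []) ⊗ q) (p ⊗ q) ⟩
  ev g (((a , v) ∷ []) ⊗ q) +ℚ ev g (p ⊗ q)
    ≡⟨ cong₂ _+ℚ_ (ev-term⊗ g a v q) (ev-⊗ g p q) ⟩
  a *ℚ ev (shiftˡ v g) q +ℚ ev (λ u → ev (shiftˡ u g) q) p ∎

ev-lin : ∀ g f p → ev g (lin f p) ≡ ev ((f ᵀ) g) p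
ev-lin g f [] = refl
ev-lin g f ((a , v) ∷ p) =
  trans (ev-⊕ g (a · f v) (lin f p)) (cong₂ _+ℚ_ (ev-· g a (f v)) (ev-lin g f p))

bilin-cons : ∀ f t p q → bilin f (t ∷ p) q ≡ bilin f (t ∷ []) q ⊕ bilin f p q
bilin-cons f t p q = cong (_⊕ bilin f p q) (sym (++-identityʳ _))

bilin-term-cons : ∀ f a v b u q →
  bilin f ((a , v) ∷ []) ((b , u) ∷ q) ≡ (a *ℚ b) · f v u ⊕ bilin f ((a , v) ∷ []) q
bilin-term-cons f a v b u q = ++-assoc ((a *ℚ b) · f v u) _ []

ev-term-bilin : ∀ g f a v q →
  ev g (bilin f ((a , v) ∷ []) q) ≡ a *ℚ ev (λ u → ev g (f v u)) q
ev-term-bilin g f a v [] = sym (*-zeroʳ a)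
ev-term-bilin g f a v ((b , u) ∷ q) = begin
  ev g (bilin f ((a , v) ∷ []) ((b , u) ∷ q))
    ≡⟨ cong (ev g) (bilin-term-cons f a v b u q) ⟩
  ev g ((a *ℚ b) · f v u ⊕ bilin f ((a , v) ∷ []) q)
    ≡⟨ ev-⊕ g ((a *ℚ b) · f v u) (bilin f ((a , v) ∷ []) q) ⟩
  ev g ((a *ℚ b) · f v u) +ℚ ev g (bilin f ((a , v) ∷ []) q)
    ≡⟨ cong₂ _+ℚ_ (ev-· g (a *ℚ b) (f v u)) (ev-term-bilin g f a v q) ⟩
  a *ℚ b *ℚ ev g (f v u) +ℚ a *ℚ ev (λ u′ → ev g (f v u′)) q
    ≡⟨ factorˡ a b _ _ ⟩
  a *ℚ (b *ℚ ev g (f v u) +ℚ ev (λ u′ → ev g (f v u′)) q) ∎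

ev-bilin : ∀ g f p q → ev g (bilin f p q) ≡ ev (λ v → ev (λ u → ev g (f v u)) q) p
ev-bilin g f [] q = refl
ev-bilin g f ((a , v) ∷ p) q = begin
  ev g (bilin f ((a , v) ∷ p) q)
    ≡⟨ cong (ev g) (bilin-cons f (a , v) p q) ⟩
  ev g (bilin f ((a , v) ∷ []) q ⊕ bilin f p q)
    ≡⟨ ev-⊕ g (bilin f ((a , v) ∷ []) q) (bilin f p q) ⟩
  ev g (bilin f ((a , v) ∷ []) q) +ℚ ev g (bilin f p q)
    ≡⟨ cong₂ _+ℚ_ (ev-term-bilin g f a v q) (ev-bilin g f p q) ⟩
  a *ℚ ev (λ u → ev g (f v u)) q +ℚ ev (λ v′ → ev (λ u → ev g (f v′ u)) q) p ∎

ev-mono⊗ : ∀ g v q → ev g (mono v ⊗ q) ≡ ev (shiftˡ v g) q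
ev-mono⊗ g v q = trans (ev-term⊗ g 1ℚ v q) (*-identityˡ _)

ev-⊗mono : ∀ g p v → ev g (p ⊗ mono v) ≡ ev (λ t → g (t ++ v)) p
ev-⊗mono g p v = trans (ev-⊗ g p (mono v)) (ev-cong (λ t → ev-mono (shiftˡ t g) v) p)

ev-Z : ∀ f → ev f Z ≡ f [ x ] +ℚ f [ y ]
ev-Z f = trans (ev-⊕ f X Y) (cong₂ _+ℚ_ (ev-mono f [ x ]) (ev-mono f [ y ]))

ev-Z⊗ : ∀ g q → ev g (Z ⊗ q) ≡ ev (shiftˡ [ x ] g) q +ℚ ev (shiftˡ [ y ] g) q
ev-Z⊗ g q = trans (ev-⊗ g Z q) (ev-Z (λ v → ev (shiftˡ v g) q))

ev-negY⊗ : ∀ g q → ev g ((- 1ℚ) · Y ⊗ q) ≡ - ev (shiftˡ [ y ] g) q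
ev-negY⊗ g q = trans (ev-⊗ g ((- 1ℚ) · Y) q)
  (solve 1 (λ a → con (- 1ℚ) :* con 1ℚ :* a :+ con 0ℚ := :- a) refl (ev (shiftˡ [ y ] g) q))

δ : Word → Word → ℚ
δ w v with v ≟W w
... | yes _ = 1ℚ
... | no _  = 0ℚ

coeff-ev : ∀ w p → coeff w p ≡ ev (δ w) p
coeff-ev w [] = refl
coeff-ev w ((a , v) ∷ p) with v ≟W w
... | yes _ = cong₂ _+ℚ_ (sym (*-identityʳ a)) (coeff-ev w p)
... | no _  = trans (coeff-ev w p) (sym (trans (cong (_+ℚ ev (δ w) p) (*-zeroʳ a)) (+-identityˡ _)))

≅⇒≈ : ∀ {p q} → p ≅ q → p ≈ q
≅⇒≈ {p} {q} p≅q w = trans (coeff-ev w p) (trans (p≅q (δ w)) (sym (coeff-ev w q)))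

φᵀ : (Word → ℚ) → Word → ℚ
φᵀ = φW ᵀ

φᵀ-[] : ∀ g → φᵀ g [] ≡ g []
φᵀ-[] g = ev-mono g []

φᵀ-x : ∀ g t → φᵀ g (x ∷ t) ≡ φᵀ (shiftˡ [ x ] g) t +ℚ φᵀ (shiftˡ [ y ] g) t
φᵀ-x g t = ev-Z⊗ g (φW t)

φᵀ-y : ∀ g t → φᵀ g (y ∷ t) ≡ - φᵀ (shiftˡ [ y ] g) t
φᵀ-y g t = ev-negY⊗ g (φW t)

φᵀ-involutive : ∀ g v → φᵀ (φᵀ g) v ≡ g v
φᵀ-involutive g [] = trans (φᵀ-[] (φᵀ g)) (φᵀ-[] g)
φᵀ-involutive g (x ∷ v) = begin
  φᵀ (φᵀ g) (x ∷ v)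
    ≡⟨ φᵀ-x (φᵀ g) v ⟩
  ev (shiftˡ [ x ] (φᵀ g)) (φW v) +ℚ ev (shiftˡ [ y ] (φᵀ g)) (φW v)
    ≡⟨ cong₂ _+ℚ_ (ev-cong (φᵀ-x g) (φW v)) (ev-cong (φᵀ-y g) (φW v)) ⟩
  ev (λ t → φᵀ gx t +ℚ φᵀ gy t) (φW v) +ℚ ev (λ t → - φᵀ gy t) (φW v)
    ≡⟨ cong₂ _+ℚ_ (ev-+ (φᵀ gx) (φᵀ gy) (φW v)) (ev-neg (φᵀ gy) (φW v)) ⟩
  φᵀ (φᵀ gx) v +ℚ φᵀ (φᵀ gy) v +ℚ - φᵀ (φᵀ gy) v
    ≡⟨ cong₂ (λ a b → a +ℚ b +ℚ - b) (φᵀ-involutive gx v) (φᵀ-involutive gy v) ⟩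
  g (x ∷ v) +ℚ g (y ∷ v) +ℚ - g (y ∷ v)
    ≡⟨ solve 2 (λ a b → a :+ b :+ :- b := a) refl (g (x ∷ v)) (g (y ∷ v)) ⟩
  g (x ∷ v) ∎
  where gx = shiftˡ [ x ] g
        gy = shiftˡ [ y ] g
φᵀ-involutive g (y ∷ v) = begin
  φᵀ (φᵀ g) (y ∷ v)                  ≡⟨ φᵀ-y (φᵀ g) v ⟩
  - ev (shiftˡ [ y ] (φᵀ g)) (φW v)   ≡⟨ cong -_ (ev-cong (φᵀ-y g) (φW v)) ⟩
  - ev (λ t → - φᵀ gy t) (φW v)       ≡⟨ cong -_ (ev-neg (φᵀ gy) (φW v)) ⟩
  - - φᵀ (φᵀ gy) v                    ≡⟨ -‿involutive (φᵀ (φᵀ gy) v) ⟩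
  φᵀ (φᵀ gy) v                        ≡⟨ φᵀ-involutive gy v ⟩
  g (y ∷ v)                           ∎
  where gy = shiftˡ [ y ] g

ev-φY : ∀ k → ev k (φ Y) ≡ - k [ y ]
ev-φY k = begin
  ev k (φ Y)                ≡⟨ ev-lin k φW Y ⟩
  ev (φᵀ k) Y               ≡⟨ ev-mono (φᵀ k) [ y ] ⟩
  φᵀ k [ y ]                ≡⟨ φᵀ-y k [] ⟩
  - φᵀ (shiftˡ [ y ] k) []  ≡⟨ cong -_ (φᵀ-[] (shiftˡ [ y ] k)) ⟩
  - k [ y ]                 ∎

*yᵀ : (Word → ℚ) → Word → ℚ
*yᵀ = (_*W [ y ]) ᵀ

*W-[] : ∀ s → s *W [] ≡ mono s
*W-[] []      = refl
*W-[] (_ ∷ _) = refl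

*yᵀ-x : ∀ h s → *yᵀ h (x ∷ s) ≡ *yᵀ (shiftˡ [ x ] h) s
*yᵀ-x h s = ev-mono⊗ h [ x ] (s *W [ y ])

*yᵀ-y : ∀ h s →
  *yᵀ h (y ∷ s) ≡ *yᵀ (shiftˡ [ y ] h) s +ℚ (h (y ∷ y ∷ s) +ℚ h (y ∷ x ∷ s))
*yᵀ-y h s = begin
  ev h (ys*y ⊕ yys ⊕ yx ⊗ (s *W []))
    ≡⟨ trans (ev-⊕ h (ys*y ⊕ yys) (yx ⊗ (s *W [])))
             (cong (_+ℚ ev h (yx ⊗ (s *W []))) (ev-⊕ h ys*y yys)) ⟩
  ev h ys*y +ℚ ev h yys +ℚ ev h (yx ⊗ (s *W []))
    ≡⟨ cong₂ _+ℚ_ (cong₂ _+ℚ_ (ev-mono⊗ h [ y ] (s *W [ y ])) (ev-mono⊗ h [ y ] (mono (y ∷ s))))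
                  (ev-mono⊗ h (y ∷ x ∷ []) (s *W [])) ⟩
  *yᵀ hy s +ℚ ev hy (mono (y ∷ s)) +ℚ ev hyx (s *W [])
    ≡⟨ cong₂ (λ a b → *yᵀ hy s +ℚ a +ℚ b)
             (ev-mono hy (y ∷ s)) (trans (cong (ev hyx) (*W-[] s)) (ev-mono hyx s)) ⟩
  *yᵀ hy s +ℚ h (y ∷ y ∷ s) +ℚ h (y ∷ x ∷ s)
    ≡⟨ +-assoc (*yᵀ hy s) (h (y ∷ y ∷ s)) (h (y ∷ x ∷ s)) ⟩
  *yᵀ hy s +ℚ (h (y ∷ y ∷ s) +ℚ h (y ∷ x ∷ s)) ∎
  where
  ys*y = letter y ⊗ (s *W [ y ])
  yys  = letter y ⊗ mono (y ∷ s)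
  yx   = mono (y ∷ x ∷ [])
  hy   = shiftˡ [ y ] h
  hyx  = shiftˡ (y ∷ x ∷ []) h

*yᵀφᵀ-x : ∀ h s →
  *yᵀ (φᵀ h) (x ∷ s) ≡ *yᵀ (φᵀ (shiftˡ [ x ] h)) s +ℚ *yᵀ (φᵀ (shiftˡ [ y ] h)) s
*yᵀφᵀ-x h s = begin
  *yᵀ (φᵀ h) (x ∷ s)                           ≡⟨ *yᵀ-x (φᵀ h) s ⟩
  ev (shiftˡ [ x ] (φᵀ h)) (s *W [ y ])        ≡⟨ ev-cong (φᵀ-x h) (s *W [ y ]) ⟩
  ev (λ t → φᵀ hx t +ℚ φᵀ hy t) (s *W [ y ])   ≡⟨ ev-+ (φᵀ hx) (φᵀ hy) (s *W [ y ]) ⟩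
  *yᵀ (φᵀ hx) s +ℚ *yᵀ (φᵀ hy) s               ∎
  where hx = shiftˡ [ x ] h
        hy = shiftˡ [ y ] h

*yᵀφᵀ-y : ∀ h s →
  *yᵀ (φᵀ h) (y ∷ s) ≡ - (*yᵀ (φᵀ (shiftˡ [ y ] h)) s +ℚ φᵀ (shiftˡ (y ∷ x ∷ []) h) s)
*yᵀφᵀ-y h s = begin
  *yᵀ (φᵀ h) (y ∷ s)
    ≡⟨ *yᵀ-y (φᵀ h) s ⟩
  *yᵀ (shiftˡ [ y ] (φᵀ h)) s +ℚ (φᵀ h (y ∷ y ∷ s) +ℚ φᵀ h (y ∷ x ∷ s))
    ≡⟨ cong₂ _+ℚ_ (trans (ev-cong (φᵀ-y h) (s *W [ y ])) (ev-neg (φᵀ hy) (s *W [ y ])))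
                  (cong₂ _+ℚ_ (trans (φᵀ-y h (y ∷ s)) (cong -_ (φᵀ-y hy s)))
                              (trans (φᵀ-y h (x ∷ s)) (cong -_ (φᵀ-x hy s)))) ⟩
  - *yᵀ (φᵀ hy) s +ℚ (- - φᵀ hyy s +ℚ - (φᵀ hyx s +ℚ φᵀ hyy s))
    ≡⟨ solve 3 (λ a b c → :- a :+ (:- :- c :+ :- (b :+ c)) := :- (a :+ b))
         refl (*yᵀ (φᵀ hy) s) (φᵀ hyx s) (φᵀ hyy s) ⟩
  - (*yᵀ (φᵀ hy) s +ℚ φᵀ hyx s) ∎
  where
  hy  = shiftˡ [ y ] h
  hyx = shiftˡ (y ∷ x ∷ []) h
  hyy = shiftˡ (y ∷ y ∷ []) h

-- The transpose of v ↦ φ(φ(v) * y); since φ(y) = -y it is minus the transpose of v ↦ v ⋄ y.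
φ*yφᵀ : (Word → ℚ) → Word → ℚ
φ*yφᵀ h = φᵀ (*yᵀ (φᵀ h))

φ*yφᵀ-[] : ∀ h → φ*yφᵀ h [] ≡ - h [ y ]
φ*yφᵀ-[] h = begin
  φ*yφᵀ h []                ≡⟨ φᵀ-[] (*yᵀ (φᵀ h)) ⟩
  ev (φᵀ h) (mono [ y ])    ≡⟨ ev-mono (φᵀ h) [ y ] ⟩
  φᵀ h [ y ]                ≡⟨ φᵀ-y h [] ⟩
  - φᵀ (shiftˡ [ y ] h) []  ≡⟨ cong -_ (φᵀ-[] (shiftˡ [ y ] h)) ⟩
  - h [ y ]                 ∎

φ*yφᵀ-x : ∀ h v → φ*yφᵀ h (x ∷ v) ≡ φ*yφᵀ (shiftˡ [ x ] h) v +ℚ - h (y ∷ x ∷ v)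
φ*yφᵀ-x h v = begin
  φ*yφᵀ h (x ∷ v)
    ≡⟨ φᵀ-x (*yᵀ (φᵀ h)) v ⟩
  ev (shiftˡ [ x ] (*yᵀ (φᵀ h))) (φW v) +ℚ ev (shiftˡ [ y ] (*yᵀ (φᵀ h))) (φW v)
    ≡⟨ cong₂ _+ℚ_ (ev-cong (*yᵀφᵀ-x h) (φW v)) (ev-cong (*yᵀφᵀ-y h) (φW v)) ⟩
  ev (λ s → *yᵀ (φᵀ hx) s +ℚ *yᵀ (φᵀ hy) s) (φW v)
    +ℚ ev (λ s → - (*yᵀ (φᵀ hy) s +ℚ φᵀ hyx s)) (φW v)
    ≡⟨ cong₂ _+ℚ_ (ev-+ (*yᵀ (φᵀ hx)) (*yᵀ (φᵀ hy)) (φW v))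
                  (trans (ev-neg _ (φW v)) (cong -_ (ev-+ (*yᵀ (φᵀ hy)) (φᵀ hyx) (φW v)))) ⟩
  φ*yφᵀ hx v +ℚ φ*yφᵀ hy v +ℚ - (φ*yφᵀ hy v +ℚ φᵀ (φᵀ hyx) v)
    ≡⟨ cong (λ a → φ*yφᵀ hx v +ℚ φ*yφᵀ hy v +ℚ - (φ*yφᵀ hy v +ℚ a))
            (φᵀ-involutive hyx v) ⟩
  φ*yφᵀ hx v +ℚ φ*yφᵀ hy v +ℚ - (φ*yφᵀ hy v +ℚ h (y ∷ x ∷ v))
    ≡⟨ solve 3 (λ a b c → a :+ b :+ :- (b :+ c) := a :+ :- c) refl
         (φ*yφᵀ hx v) (φ*yφᵀ hy v) (h (y ∷ x ∷ v)) ⟩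
  φ*yφᵀ hx v +ℚ - h (y ∷ x ∷ v) ∎
  where
  hx  = shiftˡ [ x ] h
  hy  = shiftˡ [ y ] h
  hyx = shiftˡ (y ∷ x ∷ []) h

φ*yφᵀ-y : ∀ h v → φ*yφᵀ h (y ∷ v) ≡ φ*yφᵀ (shiftˡ [ y ] h) v +ℚ h (y ∷ x ∷ v)
φ*yφᵀ-y h v = begin
  φ*yφᵀ h (y ∷ v)
    ≡⟨ φᵀ-y (*yᵀ (φᵀ h)) v ⟩
  - ev (shiftˡ [ y ] (*yᵀ (φᵀ h))) (φW v)
    ≡⟨ cong -_ (ev-cong (*yᵀφᵀ-y h) (φW v)) ⟩
  - ev (λ s → - (*yᵀ (φᵀ hy) s +ℚ φᵀ hyx s)) (φW v)
    ≡⟨ cong -_ (trans (ev-neg _ (φW v)) (cong -_ (ev-+ (*yᵀ (φᵀ hy)) (φᵀ hyx) (φW v)))) ⟩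
  - - (φ*yφᵀ hy v +ℚ φᵀ (φᵀ hyx) v)
    ≡⟨ -‿involutive _ ⟩
  φ*yφᵀ hy v +ℚ φᵀ (φᵀ hyx) v
    ≡⟨ cong (φ*yφᵀ hy v +ℚ_) (φᵀ-involutive hyx v) ⟩
  φ*yφᵀ hy v +ℚ h (y ∷ x ∷ v) ∎
  where
  hy  = shiftˡ [ y ] h
  hyx = shiftˡ (y ∷ x ∷ []) h

∂₁ᵀ : (Word → ℚ) → Word → ℚ
∂₁ᵀ = ∂₁W ᵀ

∂₁ᵀ-x : ∀ h v → ∂₁ᵀ h (x ∷ v) ≡ h (y ∷ x ∷ v) +ℚ ∂₁ᵀ (shiftˡ [ x ] h) v
∂₁ᵀ-x h v = trans (ev-⊕ h (mono (y ∷ x ∷ []) ⊗ mono v) (letter x ⊗ ∂₁W v))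
  (cong₂ _+ℚ_ (trans (ev-mono⊗ h (y ∷ x ∷ []) (mono v)) (ev-mono (shiftˡ (y ∷ x ∷ []) h) v))
              (ev-mono⊗ h [ x ] (∂₁W v)))

∂₁ᵀ-y : ∀ h v → ∂₁ᵀ h (y ∷ v) ≡ - h (y ∷ x ∷ v) +ℚ ∂₁ᵀ (shiftˡ [ y ] h) v
∂₁ᵀ-y h v = trans (ev-⊕ h (-yx ⊗ mono v) (letter y ⊗ ∂₁W v))
  (cong₂ _+ℚ_ -yx-term (ev-mono⊗ h [ y ] (∂₁W v)))
  where
  -yx = (- 1ℚ) · mono (y ∷ x ∷ [])
  hv  = λ t → h (t ++ v)
  -yx-term : ev h (-yx ⊗ mono v) ≡ - h (y ∷ x ∷ v)
  -yx-term = begin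
    ev h (-yx ⊗ mono v)                    ≡⟨ ev-⊗mono h -yx v ⟩
    ev hv -yx                              ≡⟨ ev-· hv (- 1ℚ) (mono (y ∷ x ∷ [])) ⟩
    - 1ℚ *ℚ ev hv (mono (y ∷ x ∷ []))      ≡⟨ cong (- 1ℚ *ℚ_) (ev-mono hv (y ∷ x ∷ [])) ⟩
    - 1ℚ *ℚ h (y ∷ x ∷ v)                  ≡⟨ -1*x≈-x (h (y ∷ x ∷ v)) ⟩
    - h (y ∷ x ∷ v)                        ∎

∂₁⊕yᵀ : (Word → ℚ) → Word → ℚ
∂₁⊕yᵀ h v = ∂₁ᵀ h v +ℚ h (v ++ [ y ])

φ*yφᵀ≡-∂₁⊕yᵀ : ∀ h v → φ*yφᵀ h v ≡ - ∂₁⊕yᵀ h v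
φ*yφᵀ≡-∂₁⊕yᵀ h [] = trans (φ*yφᵀ-[] h) (cong -_ (sym (+-identityˡ (h [ y ]))))
φ*yφᵀ≡-∂₁⊕yᵀ h (x ∷ v) = begin
  φ*yφᵀ h (x ∷ v)
    ≡⟨ φ*yφᵀ-x h v ⟩
  φ*yφᵀ hx v +ℚ - h (y ∷ x ∷ v)
    ≡⟨ cong (_+ℚ - h (y ∷ x ∷ v)) (φ*yφᵀ≡-∂₁⊕yᵀ hx v) ⟩
  - (∂₁ᵀ hx v +ℚ hx (v ++ [ y ])) +ℚ - h (y ∷ x ∷ v)
    ≡⟨ solve 3 (λ a w r → :- (a :+ w) :+ :- r := :- (r :+ a :+ w)) refl
         (∂₁ᵀ hx v) (hx (v ++ [ y ])) (h (y ∷ x ∷ v)) ⟩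
  - (h (y ∷ x ∷ v) +ℚ ∂₁ᵀ hx v +ℚ hx (v ++ [ y ]))
    ≡⟨ cong (λ a → - (a +ℚ hx (v ++ [ y ]))) (∂₁ᵀ-x h v) ⟨
  - ∂₁⊕yᵀ h (x ∷ v) ∎
  where hx = shiftˡ [ x ] h
φ*yφᵀ≡-∂₁⊕yᵀ h (y ∷ v) = begin
  φ*yφᵀ h (y ∷ v)
    ≡⟨ φ*yφᵀ-y h v ⟩
  φ*yφᵀ hy v +ℚ h (y ∷ x ∷ v)
    ≡⟨ cong (_+ℚ h (y ∷ x ∷ v)) (φ*yφᵀ≡-∂₁⊕yᵀ hy v) ⟩
  - (∂₁ᵀ hy v +ℚ hy (v ++ [ y ])) +ℚ h (y ∷ x ∷ v)
    ≡⟨ solve 3 (λ a w r → :- (a :+ w) :+ r := :- (:- r :+ a :+ w)) refl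
         (∂₁ᵀ hy v) (hy (v ++ [ y ])) (h (y ∷ x ∷ v)) ⟩
  - (- h (y ∷ x ∷ v) +ℚ ∂₁ᵀ hy v +ℚ hy (v ++ [ y ]))
    ≡⟨ cong (λ a → - (a +ℚ hy (v ++ [ y ]))) (∂₁ᵀ-y h v) ⟨
  - ∂₁⊕yᵀ h (y ∷ v) ∎
  where hy = shiftˡ [ y ] h

ev-∂₁⊕⊗Y : ∀ h p → ev h (∂₁ p ⊕ p ⊗ Y) ≡ ev (∂₁⊕yᵀ h) p
ev-∂₁⊕⊗Y h p = begin
  ev h (∂₁ p ⊕ p ⊗ Y)
    ≡⟨ ev-⊕ h (∂₁ p) (p ⊗ Y) ⟩
  ev h (∂₁ p) +ℚ ev h (p ⊗ Y)
    ≡⟨ cong₂ _+ℚ_ (ev-lin h ∂₁W p) (ev-⊗mono h p [ y ]) ⟩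
  ev (∂₁ᵀ h) p +ℚ ev (λ v → h (v ++ [ y ])) p
    ≡⟨ ev-+ (∂₁ᵀ h) (λ v → h (v ++ [ y ])) p ⟨
  ev (∂₁⊕yᵀ h) p ∎

⋄Y≅∂₁⊕⊗Y : ∀ p → p ⋄ Y ≅ ∂₁ p ⊕ p ⊗ Y
⋄Y≅∂₁⊕⊗Y p h = begin
  ev h (φ (φ p * φ Y))
    ≡⟨ ev-lin h φW (φ p * φ Y) ⟩
  ev (φᵀ h) (φ p * φ Y)
    ≡⟨ ev-bilin (φᵀ h) _*W_ (φ p) (φ Y) ⟩
  ev (λ v → ev (λ u → ev (φᵀ h) (v *W u)) (φ Y)) (φ p)
    ≡⟨ ev-cong (λ v → ev-φY (λ u → ev (φᵀ h) (v *W u))) (φ p) ⟩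
  ev (λ v → - *yᵀ (φᵀ h) v) (φ p)
    ≡⟨ ev-lin _ φW p ⟩
  ev (φᵀ (λ v → - *yᵀ (φᵀ h) v)) p
    ≡⟨ ev-cong (λ v → trans (ev-neg (*yᵀ (φᵀ h)) (φW v))
                            (cong -_ (φ*yφᵀ≡-∂₁⊕yᵀ h v))) p ⟩
  ev (λ v → - - ∂₁⊕yᵀ h v) p
    ≡⟨ ev-cong (λ v → -‿involutive (∂₁⊕yᵀ h v)) p ⟩
  ev (∂₁⊕yᵀ h) p
    ≡⟨ ev-∂₁⊕⊗Y h p ⟨
  ev h (∂₁ p ⊕ p ⊗ Y) ∎

ev-H : ∀ g p → ev g (H p) ≡ ev (λ t → ℕtoℚ (length t) *ℚ g t) p
ev-H g p = trans (ev-lin g (λ w → ℕtoℚ (length w) · mono w) p) (ev-cong degree-term p)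
  where
  degree-term : ∀ t → ev g (ℕtoℚ (length t) · mono t) ≡ ℕtoℚ (length t) *ℚ g t
  degree-term t = trans (ev-· g (ℕtoℚ (length t)) (mono t)) (cong (ℕtoℚ (length t) *ℚ_) (ev-mono g t))

θ̃ᵀ : ℚ → (Word → ℚ) → Word → ℚ
θ̃ᵀ c g t = (θW c ᵀ) g t +ℚ c *ℚ (ℕtoℚ (length t) *ℚ g (t ++ [ y ]))

ev-θ̃ : ∀ c g p → ev g (θ̃ c p) ≡ ev (θ̃ᵀ c g) p
ev-θ̃ c g p = begin
  ev g (θ c p ⊕ c · (H p ⊗ Y))
    ≡⟨ ev-⊕ g (θ c p) (c · (H p ⊗ Y)) ⟩
  ev g (θ c p) +ℚ ev g (c · (H p ⊗ Y))
    ≡⟨ cong₂ _+ℚ_ (ev-lin g (θW c) p)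
                  (trans (ev-· g c (H p ⊗ Y))
                         (cong (c *ℚ_) (trans (ev-⊗mono g (H p) [ y ]) (ev-H gy p)))) ⟩
  ev ((θW c ᵀ) g) p +ℚ c *ℚ ev (λ t → ℕtoℚ (length t) *ℚ gy t) p
    ≡⟨ cong (ev ((θW c ᵀ) g) p +ℚ_) (ev-*ℚ c (λ t → ℕtoℚ (length t) *ℚ gy t) p) ⟨
  ev ((θW c ᵀ) g) p +ℚ ev (λ t → c *ℚ (ℕtoℚ (length t) *ℚ gy t)) p
    ≡⟨ ev-+ ((θW c ᵀ) g) (λ t → c *ℚ (ℕtoℚ (length t) *ℚ gy t)) p ⟨
  ev (θ̃ᵀ c g) p ∎
  where gy = λ t → g (t ++ [ y ])

θ̃ᵀ-cons : ∀ c g l t → θ̃ᵀ c g (l ∷ t) ≡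
  θ̃ᵀ c (shiftˡ [ l ] g) t
    +ℚ ((g (l ∷ x ∷ t) +ℚ g (l ∷ y ∷ t)) +ℚ c *ℚ ∂₁⊕yᵀ (shiftˡ [ l ] g) t)
θ̃ᵀ-cons c g l t = begin
  ev g (lZ ⊗ mono t ⊕ lθ ⊕ c · l∂₁) +ℚ c *ℚ (ℕtoℚ (suc n) *ℚ w)
    ≡⟨ cong₂ _+ℚ_ (trans (ev-⊕ g (lZ ⊗ mono t ⊕ lθ) (c · l∂₁))
                         (cong (_+ℚ ev g (c · l∂₁)) (ev-⊕ g (lZ ⊗ mono t) lθ)))
                  (cong (λ m → c *ℚ (m *ℚ w)) (ℕtoℚ-suc n)) ⟩
  ev g (lZ ⊗ mono t) +ℚ ev g lθ +ℚ ev g (c · l∂₁) +ℚ c *ℚ ((1ℚ +ℚ ℕtoℚ n) *ℚ w)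
    ≡⟨ cong (_+ℚ c *ℚ ((1ℚ +ℚ ℕtoℚ n) *ℚ w))
            (cong₂ _+ℚ_ (cong₂ _+ℚ_ Z-term θ-term) ∂₁-term) ⟩
  a₁ +ℚ a₂ +ℚ (θW c ᵀ) gl t +ℚ c *ℚ ∂₁ᵀ gl t +ℚ c *ℚ ((1ℚ +ℚ ℕtoℚ n) *ℚ w)
    ≡⟨ solve 7 (λ a₁ a₂ b c d m w → a₁ :+ a₂ :+ b :+ c :* d :+ c :* ((con 1ℚ :+ m) :* w)
                                   := b :+ c :* (m :* w) :+ ((a₁ :+ a₂) :+ c :* (d :+ w)))
         refl a₁ a₂ ((θW c ᵀ) gl t) c (∂₁ᵀ gl t) (ℕtoℚ n) w ⟩
  θ̃ᵀ c gl t +ℚ ((a₁ +ℚ a₂) +ℚ c *ℚ ∂₁⊕yᵀ gl t) ∎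
  where
  n   = length t
  w   = g (l ∷ t ++ [ y ])
  gl  = shiftˡ [ l ] g
  lZ  = letter l ⊗ Z
  lθ  = letter l ⊗ θW c t
  l∂₁ = H (letter l) ⊗ ∂₁W t
  a₁  = g (l ∷ x ∷ t)
  a₂  = g (l ∷ y ∷ t)
  Z-term : ev g (lZ ⊗ mono t) ≡ a₁ +ℚ a₂
  Z-term = trans (ev-⊗mono g lZ t)
                 (trans (ev-mono⊗ (λ u → g (u ++ t)) [ l ] Z) (ev-Z (λ u → g (l ∷ u ++ t))))
  θ-term : ev g lθ ≡ (θW c ᵀ) gl t
  θ-term = ev-mono⊗ g [ l ] (θW c t)
  ∂₁-term : ev g (c · l∂₁) ≡ c *ℚ ∂₁ᵀ gl t
  ∂₁-term = begin
    ev g (c · l∂₁)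
      ≡⟨ ev-· g c l∂₁ ⟩
    c *ℚ ev g l∂₁
      ≡⟨ cong (c *ℚ_) (ev-⊗ g (H (letter l)) (∂₁W t)) ⟩
    c *ℚ ev (λ v → ∂₁ᵀ (shiftˡ v g) t) (H (letter l))
      ≡⟨ cong (c *ℚ_) (ev-H (λ v → ∂₁ᵀ (shiftˡ v g) t) (letter l)) ⟩
    c *ℚ ev (λ v → ℕtoℚ (length v) *ℚ ∂₁ᵀ (shiftˡ v g) t) (letter l)
      ≡⟨ cong (c *ℚ_) (trans (ev-mono (λ v → ℕtoℚ (length v) *ℚ ∂₁ᵀ (shiftˡ v g) t) [ l ])
                             (*-identityˡ (∂₁ᵀ gl t))) ⟩
    c *ℚ ∂₁ᵀ gl t ∎

θ̃ᵀ-shiftˡ-letter : ∀ c l g p →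
  ev (shiftˡ [ l ] (θ̃ᵀ c g)) p ≡ ev (shiftˡ [ l ] g) (θ̃ c p ⊕ Z ⊗ p ⊕ c · (p ⋄ Y))
θ̃ᵀ-shiftˡ-letter c l g p = begin
  ev (shiftˡ [ l ] (θ̃ᵀ c g)) p
    ≡⟨ ev-cong (θ̃ᵀ-cons c g l) p ⟩
  ev (λ t → θ̃ᵀ c gl t +ℚ (glZ t +ℚ c *ℚ ∂₁⊕yᵀ gl t)) p
    ≡⟨ trans (ev-+ (θ̃ᵀ c gl) (λ t → glZ t +ℚ c *ℚ ∂₁⊕yᵀ gl t) p)
             (cong (ev (θ̃ᵀ c gl) p +ℚ_) (trans (ev-+ glZ (λ t → c *ℚ ∂₁⊕yᵀ gl t) p)
                                                (cong (ev glZ p +ℚ_) (ev-*ℚ c (∂₁⊕yᵀ gl) p)))) ⟩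
  ev (θ̃ᵀ c gl) p +ℚ (ev glZ p +ℚ c *ℚ ev (∂₁⊕yᵀ gl) p)
    ≡⟨ cong₂ (λ a b → a +ℚ (b +ℚ c *ℚ ev (∂₁⊕yᵀ gl) p))
             (ev-θ̃ c gl p) (sym (ev-+ (shiftˡ [ x ] gl) (shiftˡ [ y ] gl) p)) ⟨
  ev gl (θ̃ c p) +ℚ (ev (shiftˡ [ x ] gl) p +ℚ ev (shiftˡ [ y ] gl) p +ℚ c *ℚ ev (∂₁⊕yᵀ gl) p)
    ≡⟨ cong₂ (λ a b → ev gl (θ̃ c p) +ℚ (a +ℚ b)) (ev-Z⊗ gl p) ⋄-term ⟨
  ev gl (θ̃ c p) +ℚ (ev gl (Z ⊗ p) +ℚ ev gl (c · (p ⋄ Y)))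
    ≡⟨ +-assoc (ev gl (θ̃ c p)) (ev gl (Z ⊗ p)) (ev gl (c · (p ⋄ Y))) ⟨
  ev gl (θ̃ c p) +ℚ ev gl (Z ⊗ p) +ℚ ev gl (c · (p ⋄ Y))
    ≡⟨ trans (ev-⊕ gl (θ̃ c p ⊕ Z ⊗ p) (c · (p ⋄ Y)))
             (cong (_+ℚ ev gl (c · (p ⋄ Y))) (ev-⊕ gl (θ̃ c p) (Z ⊗ p))) ⟨
  ev gl (θ̃ c p ⊕ Z ⊗ p ⊕ c · (p ⋄ Y)) ∎
  where
  gl = shiftˡ [ l ] g
  glZ : Word → ℚ
  glZ t = g (l ∷ x ∷ t) +ℚ g (l ∷ y ∷ t)
  ⋄-term : ev gl (c · (p ⋄ Y)) ≡ c *ℚ ev (∂₁⊕yᵀ gl) p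
  ⋄-term = trans (ev-· gl c (p ⋄ Y))
                 (cong (c *ℚ_) (trans (⋄Y≅∂₁⊕⊗Y p gl) (ev-∂₁⊕⊗Y gl p)))

ev-αX⊕βY-cong : ∀ f f′ α β → (∀ l → f [ l ] ≡ f′ [ l ]) →
  ev f (α · X ⊕ β · Y) ≡ ev f′ (α · X ⊕ β · Y)
ev-αX⊕βY-cong f f′ α β f≡f′ =
  cong₂ (λ a b → α *ℚ 1ℚ *ℚ a +ℚ (β *ℚ 1ℚ *ℚ b +ℚ 0ℚ)) (f≡f′ x) (f≡f′ y)

lemma2p5 : (c α β : ℚ) (w : 𝔥) →
    θ̃ c ((α · X ⊕ β · Y) ⊗ w)
      ≈ (α · X ⊕ β · Y) ⊗ (θ̃ c w ⊕ Z ⊗ w ⊕ c · (w ⋄ Y))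
lemma2p5 c α β w = ≅⇒≈ {θ̃ c (u ⊗ w)} {u ⊗ r} λ g → begin
  ev g (θ̃ c (u ⊗ w))
    ≡⟨ ev-θ̃ c g (u ⊗ w) ⟩
  ev (θ̃ᵀ c g) (u ⊗ w)
    ≡⟨ ev-⊗ (θ̃ᵀ c g) u w ⟩
  ev (λ v → ev (shiftˡ v (θ̃ᵀ c g)) w) u
    ≡⟨ ev-αX⊕βY-cong (λ v → ev (shiftˡ v (θ̃ᵀ c g)) w) (λ v → ev (shiftˡ v g) r) α β
                     (λ l → θ̃ᵀ-shiftˡ-letter c l g w) ⟩
  ev (λ v → ev (shiftˡ v g) r) u
    ≡⟨ ev-⊗ g u r ⟨
  ev g (u ⊗ r) ∎
  where
  u = α · X ⊕ β · Y
  r = θ̃ c w ⊕ Z ⊗ w ⊕ c · (w ⋄ Y)
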